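{- Let $m\ge 1$ be an integer and let $G$ be a finite simple graph with ${\rm im}(G)=t$. Then ${\rm im}(\mu_m(G))\ge t+1$.
   Context: For graphs $G$ and $H$, $G$ has an $H$-immersion if there is a one-to-one map $\phi:V(H)\to V(G)$ such that for each edge $uv\in E(H)$ there is a path $P_{uv}$ in $G$ joining $\phi(u)$ and $\phi(v)$, with the paths $P_{uv}$ pairwise edge-disjoint. The immersion number ${\rm im}(G)$ is the largest $t$ such that $G$ has a $K_t$-immersion. For an integer $m\ge1$, the $m$-Mycielskian $\mu_m(G)$ is the graph with vertex set $(V(G)\times\{0,1,\dots,m-1\})\cup\{w\}$ and edges $(u,0)(v,0)$ and $(u,i)(v,i+1)$ for all $uv\in E(G)$ (with $(u,i)(v,i+1)$ for $0\le i\le m-2$, in both orientations of $uv$), together with edges $(u,m-1)w$ for all $u\in V(G)$. -}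

module Defs where

open import Data.Nat using (ℕ; zero; suc; _≤_)
open import Data.Fin using (Fin; toℕ; _<_)
open import Data.Product using (Σ; _×_; _,_)
open import Data.Sum using (_⊎_; inj₁; inj₂)
open import Data.Unit using (⊤; tt)
open import Data.Empty using (⊥)
open import Data.List using (List; []; _∷_)
open import Data.List.Relation.Unary.Unique.Propositional using (Unique)
open import Relation.Binary.PropositionalEquality using (_≡_)
open import Relation.Nullary using (¬_)
open import Function.Definitions using (Injective)

-- A (loopless, undirected) graph on vertex type V is given by its adjacency
-- relation; simplicity (symmetry, irreflexivity) is imposed where needed.
Rel : Set → Set₁
Rel V = V → V → Set

Symmetric : {V : Set} → Rel V → Set
Symmetric {V} E = ∀ {x y : V} → E x y → E y x

Irreflexive : {V : Set} → Rel V → Set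
Irreflexive {V} E = ∀ {x : V} → ¬ E x x

data Walk {V : Set} (E : Rel V) : V → V → Set where
  nil  : ∀ {a} → Walk E a a
  cons : ∀ {a c b} → E a c → Walk E c b → Walk E a b

verts : ∀ {V : Set} {E : Rel V} {a b : V} → Walk E a b → List V
verts {a = a} nil = a ∷ []
verts {a = a} (cons _ w) = a ∷ verts w

IsPath : ∀ {V : Set} {E : Rel V} {a b : V} → Walk E a b → Set
IsPath w = Unique (verts w)

data UsesEdge {V : Set} {E : Rel V} (x y : V) : {a b : V} → Walk E a b → Set where
  here-fwd : ∀ {b} {e : E x y} {w : Walk E y b} → UsesEdge x y (cons e w)
  here-bwd : ∀ {b} {e : E y x} {w : Walk E x b} → UsesEdge x y (cons e w)
  there    : ∀ {a c b} {e : E a c} {w : Walk E c b} →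
             UsesEdge x y w → UsesEdge x y (cons e w)

HasImmersion : {V : Set} → Rel V → ℕ → Set
HasImmersion {V} E t =
  Σ (Fin t → V) λ φ →
  Injective _≡_ _≡_ φ ×
  Σ (∀ (i j : Fin t) → i < j → Walk E (φ i) (φ j)) λ P →
    (∀ i j (p : i < j) → IsPath (P i j p)) ×
    (∀ i j (p : i < j) i' j' (p' : i' < j') →
       ¬ (i ≡ i' × j ≡ j') →
       ∀ (x y : V) → UsesEdge x y (P i j p) → ¬ UsesEdge x y (P i' j' p'))

ImmersionNumber : {V : Set} → Rel V → ℕ → Set
ImmersionNumber E t = HasImmersion E t × (∀ s → HasImmersion E s → s ≤ t)

-- The m-Mycielskian of a graph E on Fin n. Vertices: (Fin n × Fin m) ⊎ ⊤,
-- where inj₁ (u , i) is (u , i) and inj₂ tt is w.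
MyV : ℕ → ℕ → Set
MyV n m = (Fin n × Fin m) ⊎ ⊤

Mycielski : {n : ℕ} → (m : ℕ) → Rel (Fin n) → Rel (MyV n m)
Mycielski m E (inj₁ (u , i)) (inj₁ (v , j)) =
  E u v × ((toℕ i ≡ 0 × toℕ j ≡ 0) ⊎ (toℕ j ≡ suc (toℕ i)) ⊎ (toℕ i ≡ suc (toℕ j)))
Mycielski m E (inj₁ (u , i)) (inj₂ tt) = suc (toℕ i) ≡ m
Mycielski m E (inj₂ tt) (inj₁ (v , j)) = suc (toℕ j) ≡ m
Mycielski m E (inj₂ tt) (inj₂ tt) = ⊥

-- Put the branch vertices of a K_t-immersion of G on level k ∈ {0, 1} of μ_m(G),
-- with k ≡ m - 1 (mod 2), and add the apex w as a new branch vertex. Each path of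
-- the old immersion is copied into the levels ≤ k (for k = 1 its interior runs on
-- level 0). The path from w to the branch vertex of a zigzags down between copies
-- of a, at even distance above level k, and copies of a fixed neighbour of a, at odd
-- distance; every edge of it thus has one endpoint a copy of a at even distance and
-- the other strictly above level k, which makes these paths pairwise edge-disjoint
-- and disjoint from the copied ones. Neighbours exist once t ≥ 2; t ≤ 1 is immediate.
module Submission where

open import Defs
open import Data.Nat using (ℕ; zero; suc; _+_; _*_; _≤_; _<_; z≤n; s≤s; z<s; s<s)
open import Data.Nat.Properties
  using (≤-refl; ≤-trans; ≤-reflexive; <⇒≤; <⇒≱; <-trans; n<1+n; m≤n+m; +-identityʳ; +-comm; +-cancelʳ-≡; *-comm; even≢odd)
open import Data.Fin as Fin using (Fin; zero; suc; toℕ; fromℕ; fromℕ<)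
open import Data.Fin.Properties using (toℕ-fromℕ; toℕ-fromℕ<; toℕ<n; <⇒≢)
open import Data.Product using (∃; ∃-syntax; _×_; _,_; proj₁; proj₂)
open import Data.Sum using (_⊎_; inj₁; inj₂; swap; map₁)
open import Data.Sum.Properties using (inj₁-injective)
open import Data.Unit using (⊤; tt)
open import Data.List using (_∷_; map)
open import Data.List.Relation.Unary.All as All using (All; []; _∷_)
open import Data.List.Relation.Unary.AllPairs using ([]; _∷_)
open import Data.List.Relation.Unary.Unique.Propositional using (Unique)
open import Data.List.Relation.Unary.Unique.Propositional.Properties using (map⁺; map⁻)
open import Relation.Binary.PropositionalEquality using (_≡_; _≢_; refl; sym; trans; cong; subst; subst₂)
open import Relation.Nullary using (¬_; contradiction)
open import Function.Definitions using (Injective)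

parity : ∀ s → (∃[ r ] s ≡ r * 2) ⊎ (∃[ r ] s ≡ suc (r * 2))
parity zero = inj₁ (0 , refl)
parity (suc s) with parity s
... | inj₁ (r , refl) = inj₂ (r , refl)
... | inj₂ (r , refl) = inj₁ (suc r , refl)

even+k≢odd+k : ∀ k q p → q * 2 + k ≢ suc (p * 2 + k)
even+k≢odd+k k q p eq =
  even≢odd q p (trans (*-comm 2 q) (trans (+-cancelʳ-≡ k (q * 2) (suc (p * 2)) eq) (cong suc (*-comm p 2))))

suc<⇒< : ∀ {s m} → suc s < m → s < m
suc<⇒< = <-trans (n<1+n _)

unique-over : ∀ {A B C : Set} (f : B → C) {g : A → C} → Injective _≡_ _≡_ g →
  ∀ {xs ys} → map f ys ≡ map g xs → Unique xs → Unique ys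
unique-over f g-injective eq xs! = map⁻ (subst Unique (sym eq) (map⁺ g-injective xs!))

injective-distinct : ∀ {t} {V : Set} {φ : Fin t → V} → Injective _≡_ _≡_ φ →
  ∀ {i j} → i Fin.< j → φ i ≢ φ j
injective-distinct φ-injective i<j eq = <⇒≢ i<j (φ-injective eq)

module _ {V : Set} {E : Rel V} where

  AllSteps : Rel V → ∀ {a b} → Walk E a b → Set
  AllSteps R nil = ⊤
  AllSteps R (cons {a} {c} _ w) = R a c × AllSteps R w

  AllSteps-map : ∀ {R S : Rel V} → (∀ {x y} → R x y → S x y) →
    ∀ {a b} (w : Walk E a b) → AllSteps R w → AllSteps S w
  AllSteps-map f nil _ = tt
  AllSteps-map f (cons _ w) (r , rs) = f r , AllSteps-map f w rs

  usesEdge-sym : ∀ {x y a b} {w : Walk E a b} → UsesEdge x y w → UsesEdge y x w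
  usesEdge-sym here-fwd = here-bwd
  usesEdge-sym here-bwd = here-fwd
  usesEdge-sym (there u) = there (usesEdge-sym u)

  usesEdge-step : ∀ {R : Rel V} → Symmetric R →
    ∀ {x y a b} {w : Walk E a b} → UsesEdge x y w → AllSteps R w → R x y
  usesEdge-step R-sym here-fwd (r , _) = r
  usesEdge-step R-sym here-bwd (r , _) = R-sym r
  usesEdge-step R-sym (there u) (_ , rs) = usesEdge-step R-sym u rs

  module _ (h : V → ℕ) where

    Descending : ∀ {a b} → Walk E a b → Set
    Descending = AllSteps (λ x y → h y < h x)

    descending-below-start : ∀ {a b} (w : Walk E a b) → Descending w → All (λ z → h z ≤ h a) (verts w)
    descending-below-start nil _ = ≤-refl ∷ []
    descending-below-start (cons _ w) (c<a , d) =
      ≤-refl ∷ All.map (λ z≤c → ≤-trans z≤c (<⇒≤ c<a)) (descending-below-start w d)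

    descending⇒path : ∀ {a b} (w : Walk E a b) → Descending w → IsPath w
    descending⇒path nil _ = [] ∷ []
    descending⇒path (cons _ w) (c<a , d) =
      All.map (λ z≤c a≡z → <⇒≱ c<a (subst (λ z → h z ≤ _) (sym a≡z) z≤c)) (descending-below-start w d)
        ∷ descending⇒path w d

  first-step : ∀ {a b} → Walk E a b → a ≢ b → ∃[ c ] (E a c × Walk E c b)
  first-step nil a≢b = contradiction refl a≢b
  first-step (cons e w) _ = _ , e , w

  last-neighbour : Symmetric E → ∀ {a c b} → E a c → Walk E c b → ∃ (E b)
  last-neighbour E-sym e nil = _ , E-sym e
  last-neighbour E-sym _ (cons e w) = last-neighbour E-sym e w

  branch-neighbour : Symmetric E → ∀ {t} (im : HasImmersion E (suc (suc t))) → ∀ j → ∃ (E (proj₁ im j))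
  branch-neighbour _ (φ , φ-injective , P , _) zero =
    let _ , e , _ = first-step (P zero (suc zero) z<s) (injective-distinct φ-injective z<s) in _ , e
  branch-neighbour E-sym (φ , φ-injective , P , _) (suc j) =
    let _ , e , w = first-step (P zero (suc j) z<s) (injective-distinct φ-injective z<s) in last-neighbour E-sym e w

  immersion-K₁ : V → HasImmersion E 1
  immersion-K₁ v = (λ _ → v) , (λ { {zero} {zero} _ → refl }) , (λ { _ zero () }) , (λ { _ zero () }) , λ { _ zero () }

  immersion-K₂ : ∀ {a b} → E a b → a ≢ b → HasImmersion E 2
  immersion-K₂ {a} {b} e a≢b = φ , φ-injective , P , P-path , P-disjoint
    where
    φ : Fin 2 → V
    φ zero = a
    φ (suc _) = b

    φ-injective : Injective _≡_ _≡_ φ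
    φ-injective {zero} {zero} _ = refl
    φ-injective {zero} {suc zero} eq = contradiction eq a≢b
    φ-injective {suc zero} {zero} eq = contradiction (sym eq) a≢b
    φ-injective {suc zero} {suc zero} _ = refl

    P : ∀ i j → i Fin.< j → Walk E (φ i) (φ j)
    P _ zero ()
    P zero (suc zero) _ = cons e nil
    P (suc zero) (suc zero) (s<s ())

    P-path : ∀ i j (p : i Fin.< j) → IsPath (P i j p)
    P-path _ zero ()
    P-path zero (suc zero) _ = (a≢b ∷ []) ∷ [] ∷ []
    P-path (suc zero) (suc zero) (s<s ())

    P-disjoint : ∀ i j (p : i Fin.< j) i' j' (p' : i' Fin.< j') → ¬ (i ≡ i' × j ≡ j') →
      ∀ x y → UsesEdge x y (P i j p) → ¬ UsesEdge x y (P i' j' p')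
    P-disjoint _ zero ()
    P-disjoint (suc zero) (suc zero) (s<s ())
    P-disjoint zero (suc zero) _ _ zero ()
    P-disjoint zero (suc zero) _ (suc zero) (suc zero) (s<s ())
    P-disjoint zero (suc zero) _ zero (suc zero) _ distinct = contradiction (refl , refl) distinct

module Layers {n : ℕ} (top : ℕ) (E : Rel (Fin n)) (E-sym : Symmetric E) where

  Vertex : Set
  Vertex = MyV n (suc top)

  μ : Rel Vertex
  μ = Mycielski (suc top) E

  apex : Vertex
  apex = inj₂ tt

  copy : Fin n → Fin (suc top) → Vertex
  copy u L = inj₁ (u , L)

  copy-injective : ∀ {u v L M} → copy u L ≡ copy v M → u ≡ v
  copy-injective eq = cong proj₁ (inj₁-injective eq)

  base : Vertex → Fin n ⊎ ⊤
  base = map₁ proj₁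

  height : Vertex → ℕ
  height (inj₁ (_ , L)) = toℕ L
  height (inj₂ _) = suc top

  apex-edge : ∀ u (L : Fin (suc top)) → toℕ L ≡ top → μ apex (copy u L)
  apex-edge _ _ eq = cong suc eq

  down-edge : ∀ {u v s} → E u v → (h : suc s < suc top) → μ (copy u (fromℕ< h)) (copy v (fromℕ< (suc<⇒< h)))
  down-edge e h = e , inj₂ (inj₂ (trans (toℕ-fromℕ< h) (cong suc (sym (toℕ-fromℕ< (suc<⇒< h))))))

  down-descends : ∀ {s} (h : suc s < suc top) → toℕ (fromℕ< (suc<⇒< h)) < toℕ (fromℕ< h)
  down-descends {s} h = subst₂ _<_ (sym (toℕ-fromℕ< (suc<⇒< h))) (sym (toℕ-fromℕ< h)) (n<1+n s)

  module AtLevel (k : ℕ) (k<m : k < suc top) where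

    floor : Fin (suc top)
    floor = fromℕ< k<m

    data LowEdge {a b} (Q : Walk E a b) : Vertex → Vertex → Set where
      low-edge : ∀ {u v L L'} → toℕ L ≤ k → toℕ L' ≤ k → UsesEdge u v Q → LowEdge Q (copy u L) (copy v L')

    lowEdge-sym : ∀ {a b} {Q : Walk E a b} → Symmetric (LowEdge Q)
    lowEdge-sym (low-edge L≤k L'≤k U) = low-edge L'≤k L≤k (usesEdge-sym U)

    lowEdge-there : ∀ {a c b} {e : E a c} {Q : Walk E c b} {x y} → LowEdge Q x y → LowEdge (cons e Q) x y
    lowEdge-there (low-edge L≤k L'≤k U) = low-edge L≤k L'≤k (there U)

    lowEdge-shared : ∀ {a b a' b'} {Q : Walk E a b} {Q' : Walk E a' b'} {x y} →
      LowEdge Q x y → LowEdge Q' x y → ∃[ u ] ∃[ v ] (UsesEdge u v Q × UsesEdge u v Q')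
    lowEdge-shared (low-edge _ _ U) (low-edge _ _ U') = _ , _ , U , U'

    data Anchor (a : Fin n) : Vertex → Set where
      anchor : ∀ {L} q → toℕ L ≡ q * 2 + k → Anchor a (copy a L)

    data Upper : Vertex → Set where
      upper : ∀ {z} q → height z ≡ suc (q * 2 + k) → Upper z

    ZigzagStep : Fin n → Vertex → Vertex → Set
    ZigzagStep a x y = Anchor a x × Upper y ⊎ Anchor a y × Upper x

    anchor-not-upper : ∀ {a z} → Anchor a z → ¬ Upper z
    anchor-not-upper (anchor q eq) (upper p eq') = even+k≢odd+k k q p (trans (sym eq) eq')

    upper-above-floor : ∀ {z} → Upper z → ¬ height z ≤ k
    upper-above-floor (upper q eq) z≤k = <⇒≱ (s≤s (m≤n+m k (q * 2))) (subst (_≤ k) eq z≤k)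

    zigzagStep-anchor : ∀ {a a' x y} → ZigzagStep a x y → ZigzagStep a' x y → a ≡ a'
    zigzagStep-anchor (inj₁ (anchor _ _ , _)) (inj₁ (anchor _ _ , _)) = refl
    zigzagStep-anchor (inj₂ (anchor _ _ , _)) (inj₂ (anchor _ _ , _)) = refl
    zigzagStep-anchor (inj₁ (A , _)) (inj₂ (_ , U)) = contradiction U (anchor-not-upper A)
    zigzagStep-anchor (inj₂ (_ , U)) (inj₁ (A , _)) = contradiction U (anchor-not-upper A)

    zigzagStep-not-low : ∀ {a x y c d} {Q : Walk E c d} → ZigzagStep a x y → ¬ LowEdge Q x y
    zigzagStep-not-low (inj₁ (_ , U)) (low-edge _ L'≤k _) = upper-above-floor U L'≤k
    zigzagStep-not-low (inj₂ (_ , U)) (low-edge L≤k _ _) = upper-above-floor U L≤k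

    zigzag : ∀ {a b} → E a b → ∀ q (h : q * 2 + k < suc top) → Walk μ (copy a (fromℕ< h)) (copy a floor)
    zigzag e zero h = nil
    zigzag e (suc q) h =
      cons (down-edge e h) (cons (down-edge (E-sym e) (suc<⇒< h)) (zigzag e q (suc<⇒< (suc<⇒< h))))

    zigzag-steps : ∀ {a b} (e : E a b) q h → AllSteps (ZigzagStep a) (zigzag e q h)
    zigzag-steps e zero h = tt
    zigzag-steps e (suc q) h =
      inj₁ (anchor (suc q) (toℕ-fromℕ< h) , upper q (toℕ-fromℕ< (suc<⇒< h))) ,
      inj₂ (anchor q (toℕ-fromℕ< (suc<⇒< (suc<⇒< h))) , upper q (toℕ-fromℕ< (suc<⇒< h))) ,
      zigzag-steps e q _

    zigzag-descending : ∀ {a b} (e : E a b) q h → Descending height (zigzag e q h)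
    zigzag-descending e zero h = tt
    zigzag-descending e (suc q) h = down-descends h , down-descends (suc<⇒< h) , zigzag-descending e q _

    record PathLift : Set where
      field
        lift : ∀ {a b} → Walk E a b → a ≢ b → Walk μ (copy a floor) (copy b floor)
        lift-path : ∀ {a b} (Q : Walk E a b) (a≢b : a ≢ b) → IsPath Q → IsPath (lift Q a≢b)
        lift-low : ∀ {a b} (Q : Walk E a b) (a≢b : a ≢ b) → AllSteps (LowEdge Q) (lift Q a≢b)

    extend : ∀ {t} r → r * 2 + k ≡ top → PathLift → (im : HasImmersion E t) →
      (∀ j → ∃ (E (proj₁ im j))) → HasImmersion μ (suc t)
    extend {t} r r*2+k≡top L (φ , φ-injective , P , P-path , P-disjoint) neighbour =
      ψ , ψ-injective , route , route-path , route-disjoint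
      where
      open PathLift L

      top-bound : r * 2 + k < suc top
      top-bound = s≤s (≤-reflexive r*2+k≡top)

      spoke : ∀ j → Walk μ apex (copy (φ j) floor)
      spoke j = cons (apex-edge (φ j) (fromℕ< top-bound) (trans (toℕ-fromℕ< top-bound) r*2+k≡top)) (zigzag (proj₂ (neighbour j)) r top-bound)

      spoke-step : ∀ j {x y} → UsesEdge x y (spoke j) → ZigzagStep (φ j) x y
      spoke-step j u = usesEdge-step swap u
        (inj₂ (anchor r (toℕ-fromℕ< top-bound) , upper r (cong suc (sym r*2+k≡top))) , zigzag-steps _ r top-bound)

      lift-step : ∀ {a b} (Q : Walk E a b) a≢b {x y} → UsesEdge x y (lift Q a≢b) → LowEdge Q x y
      lift-step Q a≢b u = usesEdge-step lowEdge-sym u (lift-low Q a≢b)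

      ψ : Fin (suc t) → Vertex
      ψ zero = apex
      ψ (suc j) = copy (φ j) floor

      ψ-injective : Injective _≡_ _≡_ ψ
      ψ-injective {zero} {zero} _ = refl
      ψ-injective {suc i} {suc j} eq = cong suc (φ-injective (copy-injective eq))

      route : ∀ i j → i Fin.< j → Walk μ (ψ i) (ψ j)
      route _ zero ()
      route zero (suc j) _ = spoke j
      route (suc i) (suc j) (s<s i<j) = lift (P i j i<j) (injective-distinct φ-injective i<j)

      route-path : ∀ i j (p : i Fin.< j) → IsPath (route i j p)
      route-path _ zero ()
      route-path zero (suc j) _ = descending⇒path height (spoke j) (toℕ<n _ , zigzag-descending _ r top-bound)
      route-path (suc i) (suc j) (s<s i<j) = lift-path (P i j i<j) _ (P-path i j i<j)

      route-disjoint : ∀ i j (p : i Fin.< j) i' j' (p' : i' Fin.< j') → ¬ (i ≡ i' × j ≡ j') →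
        ∀ x y → UsesEdge x y (route i j p) → ¬ UsesEdge x y (route i' j' p')
      route-disjoint _ zero ()
      route-disjoint _ _ _ _ zero ()
      route-disjoint zero (suc j) _ zero (suc j') _ distinct _ _ u u' =
        distinct (refl , cong suc (φ-injective (zigzagStep-anchor (spoke-step j u) (spoke-step j' u'))))
      route-disjoint zero (suc j) _ (suc i') (suc j') (s<s p') _ _ _ u u' =
        zigzagStep-not-low (spoke-step j u) (lift-step (P i' j' p') _ u')
      route-disjoint (suc i) (suc j) (s<s p) zero (suc j') _ _ _ _ u u' =
        zigzagStep-not-low (spoke-step j' u') (lift-step (P i j p) _ u)
      route-disjoint (suc i) (suc j) (s<s p) (suc i') (suc j') (s<s p') distinct _ _ u u' =
        let _ , _ , U , U' = lowEdge-shared (lift-step (P i j p) _ u) (lift-step (P i' j' p') _ u') in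
        P-disjoint i j p i' j' p' (λ { (refl , refl) → distinct (refl , refl) }) _ _ U U'

module Level₀ {n : ℕ} (top : ℕ) (E : Rel (Fin n)) (E-sym : Symmetric E) where
  open Layers top E E-sym
  open AtLevel 0 z<s

  on-floor : ∀ {a b} → Walk E a b → Walk μ (copy a zero) (copy b zero)
  on-floor nil = nil
  on-floor (cons e w) = cons (e , inj₁ (refl , refl)) (on-floor w)

  on-floor-base : ∀ {a b} (Q : Walk E a b) → map base (verts (on-floor Q)) ≡ map inj₁ (verts Q)
  on-floor-base nil = refl
  on-floor-base (cons _ w) = cong (inj₁ _ ∷_) (on-floor-base w)

  on-floor-low : ∀ {a b} (Q : Walk E a b) → AllSteps (LowEdge Q) (on-floor Q)
  on-floor-low nil = tt
  on-floor-low (cons _ w) = low-edge z≤n z≤n here-fwd , AllSteps-map lowEdge-there (on-floor w) (on-floor-low w)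

  lift₀ : PathLift
  lift₀ = record
    { lift = λ Q _ → on-floor Q
    ; lift-path = λ Q _ → unique-over base inj₁-injective (on-floor-base Q)
    ; lift-low = λ Q _ → on-floor-low Q
    }

module Level₁ {n : ℕ} (top : ℕ) (E : Rel (Fin n)) (E-sym : Symmetric E) where
  open Layers (suc top) E E-sym
  open AtLevel 1 (s<s z<s)

  ground first : Fin n → Vertex
  ground u = copy u zero
  first u = copy u (suc zero)

  rise : ∀ {u v} → E u v → μ (ground u) (first v)
  rise e = e , inj₂ (inj₁ refl)

  fall : ∀ {u v} → E u v → μ (first u) (ground v)
  fall e = e , inj₂ (inj₂ refl)

  flat : ∀ {u v} → E u v → μ (ground u) (ground v)
  flat e = e , inj₁ (refl , refl)

  along-ground : ∀ {c d b} → E c d → Walk E d b → Walk μ (ground c) (first b)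
  along-ground e nil = cons (rise e) nil
  along-ground e (cons e' w) = cons (flat e) (along-ground e' w)

  along-ground-base : ∀ {c d b} (e : E c d) (w : Walk E d b) →
    map base (verts (along-ground e w)) ≡ map inj₁ (verts (cons e w))
  along-ground-base e nil = refl
  along-ground-base e (cons e' w) = cong (inj₁ _ ∷_) (along-ground-base e' w)

  along-ground-low : ∀ {c d b} (e : E c d) (w : Walk E d b) → AllSteps (LowEdge (cons e w)) (along-ground e w)
  along-ground-low e nil = low-edge z≤n (s≤s z≤n) here-fwd , tt
  along-ground-low e (cons e' w) =
    low-edge z≤n z≤n here-fwd , AllSteps-map lowEdge-there (along-ground e' w) (along-ground-low e' w)

  climb : ∀ {a b} → Walk E a b → a ≢ b → Walk μ (first a) (first b)
  climb nil a≢b = contradiction refl a≢b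
  climb (cons e nil) _ = cons (fall e) (cons (flat (E-sym e)) (cons (rise e) nil))
  climb (cons e (cons e' w)) _ = cons (fall e) (along-ground e' w)

  climb-path : ∀ {a b} (Q : Walk E a b) (a≢b : a ≢ b) → IsPath Q → IsPath (climb Q a≢b)
  climb-path nil a≢b _ = contradiction refl a≢b
  climb-path (cons e nil) a≢b _ =
    ((λ ()) ∷ (λ ()) ∷ (λ eq → a≢b (copy-injective eq)) ∷ [])
      ∷ ((λ eq → a≢b (sym (copy-injective eq))) ∷ (λ ()) ∷ [])
      ∷ ((λ ()) ∷ [])
      ∷ [] ∷ []
  climb-path (cons e (cons e' w)) _ =
    unique-over base inj₁-injective (cong (inj₁ _ ∷_) (along-ground-base e' w))

  climb-low : ∀ {a b} (Q : Walk E a b) (a≢b : a ≢ b) → AllSteps (LowEdge Q) (climb Q a≢b)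
  climb-low nil a≢b = contradiction refl a≢b
  climb-low (cons e nil) _ =
    low-edge (s≤s z≤n) z≤n here-fwd , low-edge z≤n z≤n here-bwd , low-edge z≤n (s≤s z≤n) here-fwd , tt
  climb-low (cons e (cons e' w)) _ =
    low-edge (s≤s z≤n) z≤n here-fwd , AllSteps-map lowEdge-there (along-ground e' w) (along-ground-low e' w)

  lift₁ : PathLift
  lift₁ = record { lift = climb ; lift-path = climb-path ; lift-low = climb-low }

theorem1 : (m : ℕ) → 1 ≤ m → (n : ℕ) → (E : Rel (Fin n)) →
    Symmetric E → Irreflexive E → (t : ℕ) → ImmersionNumber E t →
    HasImmersion (Mycielski m E) (suc t)
theorem1 (suc top) _ n E E-sym _ zero _ = immersion-K₁ (inj₂ tt)
theorem1 (suc top) _ n E E-sym _ (suc zero) ((φ , _) , _) =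
  immersion-K₂ {a = apex} {b = copy (φ zero) (fromℕ top)}
    (apex-edge (φ zero) (fromℕ top) (toℕ-fromℕ top)) λ ()
  where open Layers top E E-sym
theorem1 (suc top) _ n E E-sym _ (suc (suc t)) (im , _) with parity top
... | inj₁ (r , refl) = extend r (+-identityʳ (r * 2)) lift₀ im (branch-neighbour E-sym im)
  where open Layers (r * 2) E E-sym
        open AtLevel 0 z<s
        open Level₀ (r * 2) E E-sym
... | inj₂ (r , refl) = extend r (+-comm (r * 2) 1) lift₁ im (branch-neighbour E-sym im)
  where open Layers (suc (r * 2)) E E-sym
        open AtLevel 1 (s<s z<s)
        open Level₁ (r * 2) E E-sym
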